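{- Let $p$ be a prime and let $\mathcal{C}$ be a linear $[n,k,d]_p$ code with $k\ge2$. Then either (1) $\mathcal{C}$ is MDS, in which case \[d_L(\mathcal{C})\le\left\lfloor\mu_p(n-k+1)\cdot\frac{p-1}{p}\right\rfloor+1;\] or (2) $\operatorname{def}(\mathcal{C})=s>0$, in which case \[d_L(\mathcal{C})\le\mu_p(n-k+1-s)\le\mu_p(n-k).\]
   Context: A linear $[n,k,d]_p$ code is a $k$-dimensional subspace of $\mathbb{Z}_p^n$ with minimum Hamming distance $d$; it is MDS if $d=n-k+1$, and its Singleton defect is $\operatorname{def}(\mathcal{C})=n-k+1-d$. The Lee weight of $a\in\mathbb{Z}_p$ (as an integer in $\{0,\dots,p-1\}$) is $\min\{a,p-a\}$, the Lee weight of a vector is the sum over coordinates, and $d_L(\mathcal{C})$ is the minimum Lee weight of a nonzero codeword. $\mu_p$ is the average Lee weight of the nonzero elements of $\mathbb{Z}_p$: $\mu_2=1$ and $\mu_p=\frac{p+1}{4}$ for odd $p$. -}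

module Defs where

open import Data.Nat as ℕ using (ℕ; zero; suc; NonZero; _+_; _*_; _≟_)
open import Data.Nat.DivMod using (_mod_)
open import Data.Fin as F using (Fin; toℕ)
open import Data.Integer as ℤ using (ℤ; +_)
open import Data.Rational as ℚ using (ℚ; _/_)
open import Data.Product using (Σ; ∃; _×_)
open import Relation.Binary.PropositionalEquality using (_≡_; _≢_)
open import Relation.Nullary using (yes; no)

sumFin : (m : ℕ) → (Fin m → ℕ) → ℕ
sumFin zero    f = 0
sumFin (suc m) f = f F.zero + sumFin m (λ i → f (F.suc i))


-- words of length n over ℤ_p, elements represented by Fin p = {0,…,p-1}
Word : ℕ → ℕ → Set
Word p n = Fin n → Fin p

IsZeroWord : {p n : ℕ} → Word p n → Set
IsZeroWord c = ∀ j → toℕ (c j) ≡ 0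

NonZeroWord : {p n : ℕ} → Word p n → Set
NonZeroWord c = Σ _ λ j → toℕ (c j) ≢ 0

encode : {p k n : ℕ} .{{_ : NonZero p}} → (Fin k → Fin n → Fin p) → Word p k → Word p n
encode {p} {k} G x j = sumFin k (λ i → toℕ (x i) * toℕ (G i j)) mod p

FullRank : {p k n : ℕ} .{{_ : NonZero p}} → (Fin k → Fin n → Fin p) → Set
FullRank {p} {k} G = (x : Word p k) → IsZeroWord (encode G x) → IsZeroWord x

_∈Code_ : {p k n : ℕ} .{{_ : NonZero p}} → Word p n → (Fin k → Fin n → Fin p) → Set
_∈Code_ {p} {k} c G = Σ (Word p k) λ x → ∀ j → encode G x j ≡ c j

hammingWt : {p n : ℕ} → Word p n → ℕ
hammingWt {p} {n} c = sumFin n (λ j → indicator (toℕ (c j)))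
  where
  indicator : ℕ → ℕ
  indicator zero    = 0
  indicator (suc _) = 1

leeWtElt : {p : ℕ} → Fin p → ℕ
leeWtElt {p} a = ℕ._⊓_ (toℕ a) (p ℕ.∸ toℕ a)

leeWt : {p n : ℕ} → Word p n → ℕ
leeWt {p} {n} c = sumFin n (λ j → leeWtElt (c j))

IsMinWt : {p k n : ℕ} .{{_ : NonZero p}} → (Word p n → ℕ) → (Fin k → Fin n → Fin p) → ℕ → Set
IsMinWt {p} {k} {n} wt G d =
  (Σ (Word p n) λ c → c ∈Code G × NonZeroWord c × wt c ≡ d)
  × ((c : Word p n) → c ∈Code G → NonZeroWord c → d ℕ.≤ wt c)

IsMinDist : {p k n : ℕ} .{{_ : NonZero p}} → (Fin k → Fin n → Fin p) → ℕ → Set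
IsMinDist = IsMinWt hammingWt

IsMinLeeDist : {p k n : ℕ} .{{_ : NonZero p}} → (Fin k → Fin n → Fin p) → ℕ → Set
IsMinLeeDist = IsMinWt leeWt

ℕ→ℚ : ℕ → ℚ
ℕ→ℚ m = + m / 1

μ : ℕ → ℚ
μ p with p ≟ 2
... | yes _ = ℚ.1ℚ
... | no  _ = + (p + 1) / 4

{-# OPTIONS --safe #-}
module Submission where

-- Let W = Σ_{a ∈ ℤ_p} Lee(a), so that μ_p = W / (p − 1). Since p is prime, a ↦ u + a·y
-- permutes ℤ_p whenever y ≠ 0; hence along a line {x + a·y : a ∈ ℤ_p} of words, every
-- coordinate where y is nonzero contributes exactly W to the total Lee weight.
--
-- Over the p − 1 nonzero multiples of a codeword of minimum Hamming weight d this total is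
-- W·d, so some multiple has Lee weight at most W·d / (p − 1) = μ_p·d, where d = n − k + 1 − s.
--
-- For an MDS code, pigeonhole on the p^k messages yields nonzero codewords c vanishing on the
-- coordinates 0, …, k − 2 and e vanishing on 1, …, k − 1; with k − 1 zeros already, neither
-- vanishes anywhere else. Scale e so that B·e₀ = 1 and average over the p codewords B·e + a·c:
-- coordinate 0 always contributes 1, coordinates 1, …, k − 2 nothing and each of the other d
-- coordinates W, so p·d_L ≤ p + W·d, that is d_L − 1 ≤ μ_p·d·(p − 1)/p.

open import Defs
open import Data.Nat as ℕ using (ℕ; zero; suc; NonZero; >-nonZero⁻¹; _+_; _*_; _∸_; _^_; _⊓_; _%_;
  _≤_; _<_; z≤n; s≤s; _≤?_)
open import Data.Nat.Properties
open import Data.Nat.DivMod using (_mod_; m%n<n; m%n%n≡m%n; %-distribˡ-+; %-distribˡ-*; [m+kn]%n≡m%n;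
  m*n%n≡0; m<n⇒m%n≡m; m≡m%n+[m/n]*n; /-monoˡ-≤; m*n/n≡m)
open import Data.Nat.Divisibility using (_∣_; ∣m+n∣m⇒∣n; n∣m*n; >⇒∤; m%n≡0⇒n∣m)
open import Data.Nat.Primality using (Prime; euclidsLemma; prime⇒irreducible; ¬prime[0]; ¬prime[1])
open import Data.Nat.Tactic.RingSolver using (solve-∀)
open import Data.Fin as F using (Fin; zero; suc; toℕ; _↑ˡ_; _↑ʳ_; funToFin; finToFun; combine)
open import Data.Fin.Properties using (toℕ-fromℕ<; toℕ-injective; toℕ<n; toℕ-↑ˡ; toℕ-↑ʳ; any?;
  ¬∀⟶∃¬; <⇒notInjective; punchOut-injective; pigeonhole; finToFun-funToFin; funToFin-finToFin)
import Data.Fin.Properties as FinP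
open import Data.Fin.Permutation using (permutation)
open import Data.Vec.Functional using (removeAt)
open import Data.Integer as ℤ using (ℤ; +_; -[1+_]; +≤+)
import Data.Integer.Properties as ℤP
open import Data.Integer.DivMod using (div-pos-is-/ℕ)
open import Data.Integer.Tactic.RingSolver using () renaming (solve-∀ to solveℤ-∀)
open import Data.Rational as ℚ using (ℚ; mkℚ; _/_; toℚᵘ)
import Data.Rational.Properties as ℚP
open import Data.Rational.Unnormalised as ℚᵘ using (ℚᵘ; mkℚᵘ; *≤*; *≡*) renaming (_≃_ to _≃ᵘ_)
import Data.Rational.Unnormalised.Properties as ℚᵘP
open import Data.Product using (Σ; ∃; _×_; _,_; proj₁; proj₂)
open import Data.Sum using (_⊎_; inj₁; inj₂)
open import Data.Empty using (⊥-elim)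
open import Function using (_∘_)
open import Function.Definitions using (Injective)
open import Relation.Binary.PropositionalEquality
open import Relation.Nullary using (¬_; yes; no; contradiction)
open import Algebra.Properties.Semiring.Sum +-*-semiring
  using (sum; sum-cong-≗; sum-remove; ∑-distrib-+; ∑-comm; ∑-permute; *-distribˡ-sum)
open import Algebra.Properties.Group ℚP.+-0-group using (//-rightDividesʳ)

sumFin≡sum : ∀ m (f : Fin m → ℕ) → sumFin m f ≡ sum f
sumFin≡sum zero    f = refl
sumFin≡sum (suc m) f = cong (_+_ (f zero)) (sumFin≡sum m (f ∘ suc))

sum-mono-≤ : ∀ {m} {f g : Fin m → ℕ} → (∀ i → f i ≤ g i) → sum f ≤ sum g
sum-mono-≤ {zero}  f≤g = z≤n
sum-mono-≤ {suc m} f≤g = +-mono-≤ (f≤g zero) (sum-mono-≤ (f≤g ∘ suc))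

sum-const : ∀ m c → sum {m} (λ _ → c) ≡ m * c
sum-const zero    c = refl
sum-const (suc m) c = cong (_+_ c) (sum-const m c)

sum-suc : ∀ {m} (f : Fin m → ℕ) → sum (λ i → suc (f i)) ≡ m + sum f
sum-suc {m} f = trans (∑-distrib-+ (λ _ → 1) f) (cong (_+ sum f) (trans (sum-const m 1) (*-identityʳ m)))

sum-linear : ∀ {m} b a (f g : Fin m → ℕ) → sum (λ i → b * f i + a * g i) ≡ b * sum f + a * sum g
sum-linear b a f g = begin
  sum (λ i → b * f i + a * g i)             ≡⟨ ∑-distrib-+ (λ i → b * f i) (λ i → a * g i) ⟩
  sum (λ i → b * f i) + sum (λ i → a * g i) ≡⟨ cong₂ _+_ (*-distribˡ-sum b f) (*-distribˡ-sum a g) ⟨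
  b * sum f + a * sum g                     ∎
  where open ≡-Reasoning

sum-↑ : ∀ m {n} (f : Fin (m + n) → ℕ) → sum f ≡ sum (λ i → f (i ↑ˡ n)) + sum (λ j → f (m ↑ʳ j))
sum-↑ zero    f = refl
sum-↑ (suc m) f = trans (cong (_+_ (f zero)) (sum-↑ m (f ∘ suc))) (sym (+-assoc (f zero) _ _))

≤-sum : ∀ {m} (f : Fin m → ℕ) i → f i ≤ sum f
≤-sum {suc m} f i = subst (f i ≤_) (sym (sum-remove {i = i} f)) (m≤m+n (f i) _)

injective⇒surjective : ∀ {n} (f : Fin n → Fin n) → Injective _≡_ _≡_ f → ∀ y → ∃ λ x → f x ≡ y
injective⇒surjective {suc n} f f-inj y with any? (λ x → f x F.≟ y)
... | yes found  = found
... | no  missed = ⊥-elim (<⇒notInjective (n<1+n n) punchOut∘f-inj)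
  where
  f≢y : ∀ x → f x ≢ y
  f≢y x fx≡y = missed (x , fx≡y)
  punchOut∘f-inj : Injective _≡_ _≡_ (λ x → F.punchOut (f≢y x ∘ sym))
  punchOut∘f-inj eq = f-inj (punchOut-injective (f≢y _ ∘ sym) (f≢y _ ∘ sym) eq)

sum-injective : ∀ {n} (f : Fin n → Fin n) → Injective _≡_ _≡_ f → (h : Fin n → ℕ) → sum (h ∘ f) ≡ sum h
sum-injective f f-inj h =
  sym (∑-permute h (permutation f f⁻¹ (proj₂ ∘ surj) (λ x → f-inj (proj₂ (surj (f x))))))
  where
  surj = injective⇒surjective f f-inj
  f⁻¹ = proj₁ ∘ surj

hammingWtElt : ∀ {p} → Fin p → ℕ
hammingWtElt zero    = 0
hammingWtElt (suc _) = 1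

hammingWtElt≤1 : ∀ {p} (a : Fin p) → hammingWtElt a ≤ 1
hammingWtElt≤1 zero    = z≤n
hammingWtElt≤1 (suc _) = ≤-refl

toℕ≡0⇒hammingWtElt≡0 : ∀ {p} (a : Fin p) → toℕ a ≡ 0 → hammingWtElt a ≡ 0
toℕ≡0⇒hammingWtElt≡0 zero _ = refl

toℕ≢0⇒hammingWtElt≡1 : ∀ {p} (a : Fin p) → toℕ a ≢ 0 → hammingWtElt a ≡ 1
toℕ≢0⇒hammingWtElt≡1 zero    a≢0 = contradiction refl a≢0
toℕ≢0⇒hammingWtElt≡1 (suc _) _   = refl

hammingWt≡sum : ∀ {p n} (c : Word p n) → hammingWt c ≡ sum (hammingWtElt ∘ c)
hammingWt≡sum {n = zero}  c = refl
hammingWt≡sum {n = suc n} c with c zero | hammingWt≡sum (c ∘ suc)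
... | zero  | eq = eq
... | suc _ | eq = cong suc eq

sum-hammingWtElt≤ : ∀ {p m} (x : Fin m → Fin p) → sum (hammingWtElt ∘ x) ≤ m
sum-hammingWtElt≤ {m = m} x = begin
  sum (hammingWtElt ∘ x) ≤⟨ sum-mono-≤ (hammingWtElt≤1 ∘ x) ⟩
  sum {m} (λ _ → 1)      ≡⟨ sum-const m 1 ⟩
  m * 1                  ≡⟨ *-identityʳ m ⟩
  m                      ∎
  where open ≤-Reasoning

sum-hammingWtElt< : ∀ {p m} (x : Fin (suc m) → Fin p) i → toℕ (x i) ≡ 0 → sum (hammingWtElt ∘ x) ≤ m
sum-hammingWtElt< {m = m} x i xᵢ≡0 = begin
  sum (hammingWtElt ∘ x)                                   ≡⟨ sum-remove {i = i} (hammingWtElt ∘ x) ⟩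
  hammingWtElt (x i) + sum (removeAt (hammingWtElt ∘ x) i) ≡⟨ cong (_+ sum (hammingWtElt ∘ removeAt x i))
                                                                   (toℕ≡0⇒hammingWtElt≡0 (x i) xᵢ≡0) ⟩
  sum (hammingWtElt ∘ removeAt x i)                        ≤⟨ sum-hammingWtElt≤ (removeAt x i) ⟩
  m                                                        ∎
  where open ≤-Reasoning

sum-hammingWtElt-vanishing : ∀ {p m} (x : Fin m → Fin p) → (∀ i → toℕ (x i) ≡ 0) →
  sum (hammingWtElt ∘ x) ≡ 0
sum-hammingWtElt-vanishing {m = m} x x≡0 = begin
  sum (hammingWtElt ∘ x) ≡⟨ sum-cong-≗ (λ i → toℕ≡0⇒hammingWtElt≡0 (x i) (x≡0 i)) ⟩
  sum {m} (λ _ → 0)      ≡⟨ sum-const m 0 ⟩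
  m * 0                  ≡⟨ *-zeroʳ m ⟩
  0                      ∎
  where open ≡-Reasoning

hammingWt-pos : ∀ {p n} (c : Word p n) → NonZeroWord c → 1 ≤ hammingWt c
hammingWt-pos c (j , cⱼ≢0) = begin
  1                      ≡⟨ toℕ≢0⇒hammingWtElt≡1 (c j) cⱼ≢0 ⟨
  hammingWtElt (c j)     ≤⟨ ≤-sum (hammingWtElt ∘ c) j ⟩
  sum (hammingWtElt ∘ c) ≡⟨ hammingWt≡sum c ⟨
  hammingWt c            ∎
  where open ≤-Reasoning

minDist-pos : ∀ {p k n d} .{{_ : NonZero p}} {G : Fin k → Fin n → Fin p} → IsMinDist G d → 1 ≤ d
minDist-pos ((c , _ , c≢0 , wt≡d) , _) = subst (1 ≤_) wt≡d (hammingWt-pos c c≢0)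

¬IsZeroWord⇒NonZeroWord : ∀ {p n} (c : Word p n) → ¬ IsZeroWord c → NonZeroWord c
¬IsZeroWord⇒NonZeroWord {n = n} c = ¬∀⟶∃¬ n _ (λ j → toℕ (c j) ℕ.≟ 0)

-- Arithmetic modulo p

module _ {p : ℕ} .{{_ : NonZero p}} where

  toℕ-mod : ∀ m → toℕ (m mod p) ≡ m % p
  toℕ-mod m = toℕ-fromℕ< (m%n<n m p)

  mod-cong : ∀ {m n} → m % p ≡ n % p → m mod p ≡ n mod p
  mod-cong {m} {n} eq = toℕ-injective (trans (toℕ-mod m) (trans eq (sym (toℕ-mod n))))

  +-cong-% : ∀ {m m′ n n′} → m % p ≡ m′ % p → n % p ≡ n′ % p → (m + n) % p ≡ (m′ + n′) % p
  +-cong-% {m} {m′} {n} {n′} m≡m′ n≡n′ = begin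
    (m + n) % p           ≡⟨ %-distribˡ-+ m n p ⟩
    (m % p + n % p) % p   ≡⟨ cong₂ (λ u v → (u + v) % p) m≡m′ n≡n′ ⟩
    (m′ % p + n′ % p) % p ≡⟨ %-distribˡ-+ m′ n′ p ⟨
    (m′ + n′) % p         ∎
    where open ≡-Reasoning

  *-cong-% : ∀ {m m′ n n′} → m % p ≡ m′ % p → n % p ≡ n′ % p → (m * n) % p ≡ (m′ * n′) % p
  *-cong-% {m} {m′} {n} {n′} m≡m′ n≡n′ = begin
    (m * n) % p             ≡⟨ %-distribˡ-* m n p ⟩
    (m % p * (n % p)) % p   ≡⟨ cong₂ (λ u v → (u * v) % p) m≡m′ n≡n′ ⟩
    (m′ % p * (n′ % p)) % p ≡⟨ %-distribˡ-* m′ n′ p ⟨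
    (m′ * n′) % p           ∎
    where open ≡-Reasoning

  sum-cong-% : ∀ {m} {f g : Fin m → ℕ} → (∀ i → f i % p ≡ g i % p) → sum f % p ≡ sum g % p
  sum-cong-% {zero}  f≡g = refl
  sum-cong-% {suc m} f≡g = +-cong-% (f≡g zero) (sum-cong-% (f≡g ∘ suc))

  %-+-≡⇒∣ : ∀ m n → (m + n) % p ≡ m % p → p ∣ n
  %-+-≡⇒∣ m n eq = ∣m+n∣m⇒∣n (subst (p ∣_) (sym shifted) (n∣m*n ((m + n) ℕ./ p))) (n∣m*n (m ℕ./ p))
    where
    open ≡-Reasoning
    shifted : m ℕ./ p * p + n ≡ (m + n) ℕ./ p * p
    shifted = +-cancelˡ-≡ (m % p) _ _ (begin
      m % p + (m ℕ./ p * p + n)       ≡⟨ +-assoc (m % p) _ n ⟨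
      m % p + m ℕ./ p * p + n         ≡⟨ cong (_+ n) (m≡m%n+[m/n]*n m p) ⟨
      m + n                           ≡⟨ m≡m%n+[m/n]*n (m + n) p ⟩
      (m + n) % p + (m + n) ℕ./ p * p ≡⟨ cong (_+ (m + n) ℕ./ p * p) eq ⟩
      m % p + (m + n) ℕ./ p * p       ∎)

  ∣∧<⇒≡0 : ∀ {t} → p ∣ t → t < p → t ≡ 0
  ∣∧<⇒≡0 {zero}  _   _   = refl
  ∣∧<⇒≡0 {suc t} p∣t t<p = contradiction p∣t (>⇒∤ t<p)

  lincomb : ∀ {n} → ℕ → Word p n → ℕ → Word p n → Word p n
  lincomb b x a y j = (b * toℕ (x j) + a * toℕ (y j)) mod p

  encode-lincomb : ∀ {k n} (G : Fin k → Fin n → Fin p) b x a y j →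
    encode G (lincomb b x a y) j ≡ lincomb b (encode G x) a (encode G y) j
  encode-lincomb {k} G b x a y j = mod-cong (begin
    sumFin k (λ i → toℕ (lincomb b x a y i) * g i) % p
      ≡⟨ cong (_% p) (sumFin≡sum k _) ⟩
    sum (λ i → toℕ (lincomb b x a y i) * g i) % p
      ≡⟨ sum-cong-% (λ i → *-cong-% {n = g i} (trans (cong (_% p) (toℕ-mod _)) (m%n%n≡m%n _ p)) refl) ⟩
    sum (λ i → (b * X i + a * Y i) * g i) % p
      ≡⟨ cong (_% p) (trans (sum-cong-≗ (λ i → distrib b a (X i) (Y i) (g i)))
                            (sum-linear b a (λ i → X i * g i) (λ i → Y i * g i))) ⟩
    (b * sum (λ i → X i * g i) + a * sum (λ i → Y i * g i)) % p
      ≡⟨ +-cong-% (*-cong-% {m = b} refl (reduce x)) (*-cong-% {m = a} refl (reduce y)) ⟩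
    (b * toℕ (encode G x j) + a * toℕ (encode G y j)) % p ∎)
    where
    open ≡-Reasoning
    X = λ i → toℕ (x i)
    Y = λ i → toℕ (y i)
    g = λ i → toℕ (G i j)
    distrib : ∀ b a u v w → (b * u + a * v) * w ≡ b * (u * w) + a * (v * w)
    distrib = solve-∀
    reduce : ∀ z → sum (λ i → toℕ (z i) * g i) % p ≡ toℕ (encode G z j) % p
    reduce z = sym (trans (cong (_% p) (trans (toℕ-mod _) (cong (_% p) (sumFin≡sum k _)))) (m%n%n≡m%n _ p))

  lincomb-∈Code : ∀ {k n} {G : Fin k → Fin n → Fin p} {c c′ : Word p n} b a →
    c ∈Code G → c′ ∈Code G → lincomb b c a c′ ∈Code G
  lincomb-∈Code {G = G} b a (x , x↦c) (y , y↦c′) =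
    lincomb b x a y , λ j → trans (encode-lincomb G b x a y j)
      (cong₂ (λ u v → (b * toℕ u + a * toℕ v) mod p) (x↦c j) (y↦c′ j))

  infixl 6 _-ʷ_
  _-ʷ_ : ∀ {n} → Word p n → Word p n → Word p n
  x -ʷ y = lincomb 1 x (p ∸ 1) y

  private
    1+[p∸1]≡p : 1 + (p ∸ 1) ≡ p
    1+[p∸1]≡p = m+[n∸m]≡n (>-nonZero⁻¹ p)

  ≡⇒-ʷ≡0 : ∀ {n} (x y : Word p n) j → x j ≡ y j → toℕ ((x -ʷ y) j) ≡ 0
  ≡⇒-ʷ≡0 x y j xⱼ≡yⱼ = begin
    toℕ ((x -ʷ y) j)                  ≡⟨ toℕ-mod _ ⟩
    (1 * toℕ (x j) + (p ∸ 1) * Y) % p ≡⟨ cong (λ X → (1 * toℕ X + (p ∸ 1) * Y) % p) xⱼ≡yⱼ ⟩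
    (1 * Y + (p ∸ 1) * Y) % p         ≡⟨ cong (_% p) (*-distribʳ-+ Y 1 (p ∸ 1)) ⟨
    ((1 + (p ∸ 1)) * Y) % p           ≡⟨ cong (λ m → (m * Y) % p) 1+[p∸1]≡p ⟩
    (p * Y) % p                       ≡⟨ cong (_% p) (*-comm p Y) ⟩
    (Y * p) % p                       ≡⟨ m*n%n≡0 Y p ⟩
    0                                 ∎
    where
    open ≡-Reasoning
    Y = toℕ (y j)

  -ʷ≡0⇒≡ : ∀ {n} (x y : Word p n) j → toℕ ((x -ʷ y) j) ≡ 0 → x j ≡ y j
  -ʷ≡0⇒≡ x y j x-yⱼ≡0 = toℕ-injective (begin
    X                             ≡⟨ m<n⇒m%n≡m (toℕ<n (x j)) ⟨
    X % p                         ≡⟨ [m+kn]%n≡m%n X Y p ⟨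
    (X + Y * p) % p               ≡⟨ cong (λ m → (X + Y * m) % p) 1+[p∸1]≡p ⟨
    (X + Y * (1 + (p ∸ 1))) % p   ≡⟨ cong (_% p) (regroup X Y (p ∸ 1)) ⟩
    (1 * X + (p ∸ 1) * Y + Y) % p ≡⟨ +-cong-% {n = Y} x-y%p≡0%p refl ⟩
    (0 + Y) % p                   ≡⟨ m<n⇒m%n≡m (toℕ<n (y j)) ⟩
    Y                             ∎)
    where
    open ≡-Reasoning
    X = toℕ (x j)
    Y = toℕ (y j)
    regroup : ∀ X Y q → X + Y * (1 + q) ≡ 1 * X + q * Y + Y
    regroup = solve-∀
    x-y%p≡0%p : (1 * X + (p ∸ 1) * Y) % p ≡ 0 % p
    x-y%p≡0%p = trans (sym (toℕ-mod _)) (trans x-yⱼ≡0 (sym (m<n⇒m%n≡m (>-nonZero⁻¹ p))))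

  affine : ℕ → Fin p → Fin p → Fin p
  affine u y a = (u + toℕ a * toℕ y) mod p

  affine-vanishing : ∀ u (y : Fin p) → toℕ y ≡ 0 → ∀ a → affine u y a ≡ u mod p
  affine-vanishing u y y≡0 a = cong (_mod p) (begin
    u + toℕ a * toℕ y ≡⟨ cong (λ v → u + toℕ a * v) y≡0 ⟩
    u + toℕ a * 0     ≡⟨ cong (_+_ u) (*-zeroʳ (toℕ a)) ⟩
    u + 0             ≡⟨ +-identityʳ u ⟩
    u                 ∎)
    where open ≡-Reasoning

  module _ (p-prime : Prime p) where

    *-cancelʳ-% : ∀ u {A A′} Y → ¬ p ∣ Y → A ≤ A′ → A′ < p →
      (u + A * Y) % p ≡ (u + A′ * Y) % p → A ≡ A′
    *-cancelʳ-% u {A} {A′} Y p∤Y A≤A′ A′<p eq = begin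
      A            ≡⟨ +-identityʳ A ⟨
      A + 0        ≡⟨ cong (_+_ A) t≡0 ⟨
      A + (A′ ∸ A) ≡⟨ m+[n∸m]≡n A≤A′ ⟩
      A′           ∎
      where
      open ≡-Reasoning
      t = A′ ∸ A
      split : u + A′ * Y ≡ (u + A * Y) + t * Y
      split = begin
        u + A′ * Y          ≡⟨ cong (λ B → u + B * Y) (m+[n∸m]≡n A≤A′) ⟨
        u + (A + t) * Y     ≡⟨ cong (_+_ u) (*-distribʳ-+ Y A t) ⟩
        u + (A * Y + t * Y) ≡⟨ +-assoc u _ _ ⟨
        (u + A * Y) + t * Y ∎
      t≡0 : t ≡ 0
      t≡0 with euclidsLemma t Y p-prime (%-+-≡⇒∣ (u + A * Y) (t * Y) (trans (cong (_% p) (sym split)) (sym eq)))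
      ... | inj₁ p∣t = ∣∧<⇒≡0 p∣t (≤-<-trans (m∸n≤m A′ A) A′<p)
      ... | inj₂ p∣Y = contradiction p∣Y p∤Y

    affine-cancel : ∀ u (y : Fin p) → toℕ y ≢ 0 → ∀ {a a′} → toℕ a ≤ toℕ a′ →
      affine u y a ≡ affine u y a′ → a ≡ a′
    affine-cancel u y y≢0 {a} {a′} a≤a′ eq =
      toℕ-injective (*-cancelʳ-% u (toℕ y) p∤y a≤a′ (toℕ<n a′) congruent)
      where
      p∤y : ¬ p ∣ toℕ y
      p∤y p∣y = y≢0 (∣∧<⇒≡0 p∣y (toℕ<n y))
      congruent : (u + toℕ a * toℕ y) % p ≡ (u + toℕ a′ * toℕ y) % p
      congruent = trans (sym (toℕ-mod _)) (trans (cong toℕ eq) (toℕ-mod _))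

    affine-injective : ∀ u (y : Fin p) → toℕ y ≢ 0 → Injective _≡_ _≡_ (affine u y)
    affine-injective u y y≢0 {a} {a′} eq with ≤-total (toℕ a) (toℕ a′)
    ... | inj₁ a≤a′ = affine-cancel u y y≢0 a≤a′ eq
    ... | inj₂ a′≤a = sym (affine-cancel u y y≢0 a′≤a (sym eq))

-- Lee weight along a line of words

totalLeeWt : ℕ → ℕ
totalLeeWt p = sum (leeWtElt {p})

module _ {p : ℕ} .{{_ : NonZero p}} where

  sum-leeWt : ∀ {m n} (w : Fin m → Word p n) → sum (leeWt ∘ w) ≡ sum (λ j → sum (λ a → leeWtElt (w a j)))
  sum-leeWt {n = n} w =
    trans (sum-cong-≗ (λ a → sumFin≡sum n (leeWtElt ∘ w a))) (∑-comm (λ a j → leeWtElt (w a j)))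

  minLeeDist-≤-average : ∀ {k n dL m} {G : Fin k → Fin n → Fin p} → IsMinLeeDist G dL →
    (w : Fin m → Word p n) → (∀ a → w a ∈Code G) → (∀ a → NonZeroWord (w a)) → m * dL ≤ sum (leeWt ∘ w)
  minLeeDist-≤-average {dL = dL} {m} (_ , minimal) w w∈G w≢0 = begin
    m * dL             ≡⟨ sum-const m dL ⟨
    sum {m} (λ _ → dL) ≤⟨ sum-mono-≤ (λ a → minimal (w a) (w∈G a) (w≢0 a)) ⟩
    sum (leeWt ∘ w)    ∎
    where open ≤-Reasoning

  sum-leeWtElt-affine-vanishing : ∀ u (y : Fin p) → toℕ y ≡ 0 →
    sum (leeWtElt ∘ affine u y) ≡ p * leeWtElt (u mod p)
  sum-leeWtElt-affine-vanishing u y y≡0 =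
    trans (sum-cong-≗ (cong leeWtElt ∘ affine-vanishing u y y≡0)) (sum-const p _)

  sum-leeWtElt-affine : Prime p → ∀ u (y : Fin p) → toℕ y ≢ 0 → sum (leeWtElt ∘ affine u y) ≡ totalLeeWt p
  sum-leeWtElt-affine p-prime u y y≢0 = sum-injective (affine u y) (affine-injective p-prime u y y≢0) leeWtElt

-- Codewords with prescribed zeros, and the Singleton bound

funToFin-cong : ∀ {m n} {f g : Fin m → Fin n} → (∀ i → f i ≡ g i) → funToFin f ≡ funToFin g
funToFin-cong {zero}  f≗g = refl
funToFin-cong {suc m} f≗g = cong₂ combine (f≗g zero) (funToFin-cong (f≗g ∘ suc))

finToFun-injective : ∀ {m n} {i j : Fin (n ^ m)} → (∀ t → finToFun i t ≡ finToFun j t) → i ≡ j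
finToFun-injective {m} {n} {i} {j} i≗j =
  trans (sym (funToFin-finToFin {m} {n} i)) (trans (funToFin-cong {m} {n} i≗j) (funToFin-finToFin {m} {n} j))

funToFin-injective : ∀ {m n} {f g : Fin m → Fin n} → funToFin f ≡ funToFin g → ∀ t → f t ≡ g t
funToFin-injective {f = f} {g} eq t =
  trans (sym (finToFun-funToFin f t)) (trans (cong (λ m → finToFun m t) eq) (finToFun-funToFin g t))

module _ {p : ℕ} .{{_ : NonZero p}} {k n : ℕ} (G : Fin k → Fin n → Fin p) (full : FullRank G) where

  difference-codeword : (x y : Word p k) → ¬ (∀ i → x i ≡ y i) → ∀ {r} (σ : Fin r → Fin n) →
    (∀ t → encode G x (σ t) ≡ encode G y (σ t)) →
    Σ (Word p n) λ c → c ∈Code G × NonZeroWord c × (∀ t → toℕ (c (σ t)) ≡ 0)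
  difference-codeword x y x≢y σ agree =
    encode G (x -ʷ y) , (x -ʷ y , λ _ → refl) , ¬IsZeroWord⇒NonZeroWord _ nonzero , vanish
    where
    nonzero : ¬ IsZeroWord (encode G (x -ʷ y))
    nonzero allZero = x≢y (λ i → -ʷ≡0⇒≡ x y i (full (x -ʷ y) allZero i))
    vanish : ∀ t → toℕ (encode G (x -ʷ y) (σ t)) ≡ 0
    vanish t = trans (cong toℕ (encode-lincomb G 1 x (p ∸ 1) y (σ t)))
                     (≡⇒-ʷ≡0 (encode G x) (encode G y) (σ t) (agree t))

  -- Opaque, since otherwise the checker unfolds the pigeonhole witness whenever it compares types
  -- mentioning the codeword, which exhausts memory.
  opaque
    vanishing-codeword : 1 < p → ∀ {r} → r < k → (σ : Fin r → Fin n) →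
      Σ (Word p n) λ c → c ∈Code G × NonZeroWord c × (∀ t → toℕ (c (σ t)) ≡ 0)
    vanishing-codeword 1<p {r} r<k σ
      with i , j , i<j , same ← pigeonhole (^-monoʳ-< p 1<p r<k) (λ m → funToFin (encode G (finToFun m) ∘ σ))
      = difference-codeword (finToFun i) (finToFun j) (λ i≗j → FinP.<-irrefl (finToFun-injective {k} {p} i≗j) i<j) σ
          (funToFin-injective same)

module _ {p : ℕ} .{{_ : NonZero p}} (1<p : 1 < p) where

  minDist≤ : ∀ {k n d} r e → r + e ≡ n → (G : Fin k → Fin n → Fin p) → FullRank G → r < k →
    IsMinDist G d → d ≤ e
  minDist≤ {d = d} r e refl G full r<k (_ , minimal)
    with c , c∈G , c≢0 , c↑ˡ≡0 ← vanishing-codeword G full 1<p r<k (_↑ˡ e) = begin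
    d                                       ≤⟨ minimal c c∈G c≢0 ⟩
    hammingWt c                             ≡⟨ hammingWt≡sum c ⟩
    sum (hammingWtElt ∘ c)                  ≡⟨ sum-↑ r (hammingWtElt ∘ c) ⟩
    sum (λ i → hammingWtElt (c (i ↑ˡ e))) + sum (hammingWtElt ∘ c ∘ (r ↑ʳ_))
      ≡⟨ cong (_+ sum (hammingWtElt ∘ c ∘ (r ↑ʳ_))) (sum-hammingWtElt-vanishing _ c↑ˡ≡0) ⟩
    sum (hammingWtElt ∘ c ∘ (r ↑ʳ_))        ≤⟨ sum-hammingWtElt≤ (c ∘ (r ↑ʳ_)) ⟩
    e                                       ∎
    where open ≤-Reasoning

  singleton-bound : ∀ {K n d} (G : Fin (suc K) → Fin n → Fin p) → FullRank G → IsMinDist G d →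
    d + suc K ≤ n + 1
  singleton-bound {K} {n} {d} G full minDist with K ≤? n
  ... | yes K≤n = begin
    d + suc K       ≡⟨ +-suc d K ⟩
    suc (d + K)     ≤⟨ s≤s (+-monoˡ-≤ K (minDist≤ K (n ∸ K) (m+[n∸m]≡n K≤n) G full ≤-refl minDist)) ⟩
    suc (n ∸ K + K) ≡⟨ cong suc (m∸n+n≡m K≤n) ⟩
    suc n           ≡⟨ +-comm 1 n ⟩
    n + 1           ∎
    where open ≤-Reasoning
  ... | no  K≰n = contradiction (minDist≤ n 0 (+-identityʳ n) G full (s≤s (<⇒≤ (≰⇒> K≰n))) minDist)
                                (<⇒≱ (minDist-pos {G = G} minDist))

-- The two upper bounds on the minimum Lee distance

module _ {q : ℕ} (p-prime : Prime (suc (suc q))) where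

  private
    p W : ℕ
    p = suc (suc q)
    W = totalLeeWt p

  sum-leeWtElt-multiples : ∀ (y : Fin p) → sum (λ a → leeWtElt (affine 0 y (suc a))) ≡ W * hammingWtElt y
  sum-leeWtElt-multiples zero = begin
    sum {suc q} (λ a → leeWtElt (affine 0 zero (suc a)))
      ≡⟨ sum-cong-≗ (λ a → cong leeWtElt (affine-vanishing {p} 0 zero refl (suc a))) ⟩
    sum {suc q} (λ _ → 0)                                ≡⟨ sum-const (suc q) 0 ⟩
    suc q * 0                                            ≡⟨ *-zeroʳ (suc q) ⟩
    0                                                    ≡⟨ *-zeroʳ W ⟨
    W * 0                                                ∎
    where open ≡-Reasoning
  sum-leeWtElt-multiples y@(suc _) = trans (sum-leeWtElt-affine p-prime 0 y λ ()) (sym (*-identityʳ W))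

  minLeeDist-bound : ∀ {k n d dL} (G : Fin k → Fin n → Fin p) → IsMinDist G d → IsMinLeeDist G dL →
    suc q * dL ≤ W * d
  minLeeDist-bound {n = n} {d} {dL} G ((c , c∈G , (j , cⱼ≢0) , wt≡d) , _) minLee = begin
    suc q * dL
      ≤⟨ minLeeDist-≤-average minLee w (λ a → lincomb-∈Code 0 (toℕ (suc a)) c∈G c∈G) w≢0 ⟩
    sum (leeWt ∘ w)                          ≡⟨ sum-leeWt w ⟩
    sum (λ j → sum (λ a → leeWtElt (w a j))) ≡⟨ sum-cong-≗ (sum-leeWtElt-multiples ∘ c) ⟩
    sum (λ j → W * hammingWtElt (c j))       ≡⟨ *-distribˡ-sum W (hammingWtElt ∘ c) ⟨
    W * sum (hammingWtElt ∘ c)               ≡⟨ cong (W *_) (trans (sym (hammingWt≡sum c)) wt≡d) ⟩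
    W * d                                    ∎
    where
    open ≤-Reasoning
    w : Fin (suc q) → Word p n
    w a = lincomb 0 c (toℕ (suc a)) c
    w≢0 : ∀ a → NonZeroWord (w a)
    w≢0 a = j , λ wⱼ≡0 →
      contradiction (affine-injective p-prime 0 (c j) cⱼ≢0 {suc a} {zero} (toℕ-injective wⱼ≡0)) λ ()

  -- The MDS case with k = K + 2 and n = 1 + K + d; the coordinates are 0, `middle` = 1, …, K and `tail`.
  module _ {K d′ : ℕ} (G : Fin (suc (suc K)) → Fin (suc (K + suc d′)) → Fin p) (full : FullRank G)
           (minDist : IsMinDist G (suc d′)) where

    private
      d n : ℕ
      d = suc d′
      n = suc (K + d)

    middle : Fin K → Fin n
    middle i = suc (i ↑ˡ d)

    tail : Fin d → Fin n
    tail j = suc (K ↑ʳ j)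

    sum-layout : (f : Fin n → ℕ) → sum f ≡ f zero + (sum (f ∘ middle) + sum (f ∘ tail))
    sum-layout f = cong (_+_ (f zero)) (sum-↑ K (f ∘ suc))

    hammingWt≤d′ : (x : Word p n) → toℕ (x zero) ≡ 0 → (∀ i → toℕ (x (middle i)) ≡ 0) →
      ∀ j → toℕ (x (tail j)) ≡ 0 → hammingWt x ≤ d′
    hammingWt≤d′ x x₀≡0 x-middle≡0 j xⱼ≡0 = begin
      hammingWt x                   ≡⟨ hammingWt≡sum x ⟩
      sum (hammingWtElt ∘ x)        ≡⟨ sum-layout (hammingWtElt ∘ x) ⟩
      hammingWtElt (x zero) + (sum (hammingWtElt ∘ x ∘ middle) + sum (hammingWtElt ∘ x ∘ tail))
        ≡⟨ cong₂ (λ a b → a + (b + sum (hammingWtElt ∘ x ∘ tail)))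
             (toℕ≡0⇒hammingWtElt≡0 (x zero) x₀≡0) (sum-hammingWtElt-vanishing (x ∘ middle) x-middle≡0) ⟩
      sum (hammingWtElt ∘ x ∘ tail) ≤⟨ sum-hammingWtElt< (x ∘ tail) j xⱼ≡0 ⟩
      d′                            ∎
      where open ≤-Reasoning

    hammingWt≰d′ : ∀ {x} → x ∈Code G → NonZeroWord x → ¬ (hammingWt x ≤ d′)
    hammingWt≰d′ x∈G x≢0 wt≤d′ = 1+n≰n (≤-trans (proj₂ minDist _ x∈G x≢0) wt≤d′)

    line-average-bound : ∀ {dL} → IsMinLeeDist G dL → ∀ {c e} → c ∈Code G → e ∈Code G →
      (∀ t → toℕ (c (t ↑ˡ d)) ≡ 0) → (∀ j → toℕ (c (tail j)) ≢ 0) →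
      (∀ i → toℕ (e (middle i)) ≡ 0) → toℕ (e zero) ≢ 0 → p * dL ≤ p + W * d
    line-average-bound {dL} minLee {c} {e} c∈G e∈G c-vanishes c-tail≢0 e-middle≡0 e₀≢0 = begin
      p * dL
        ≤⟨ minLeeDist-≤-average {G = G} minLee w (λ a → lincomb-∈Code {G = G} (toℕ B) (toℕ a) e∈G c∈G) w≢0 ⟩
      sum (leeWt ∘ w)
        ≡⟨ sum-leeWt w ⟩
      sum S
        ≡⟨ sum-layout S ⟩
      S zero + (sum (S ∘ middle) + sum (S ∘ tail))
        ≡⟨ cong₂ (λ a b → a + (b + sum (S ∘ tail))) S₀≡p (sum-cong-≗ S-middle≡0) ⟩
      p + (sum {K} (λ _ → 0) + sum (S ∘ tail))
        ≡⟨ cong₂ (λ a b → p + (a + b)) (trans (sum-const K 0) (*-zeroʳ K)) (sum-cong-≗ S-tail≡W) ⟩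
      p + sum {d} (λ _ → W)
        ≡⟨ cong (_+_ p) (trans (sum-const d W) (*-comm d W)) ⟩
      p + W * d
        ∎
      where
      open ≤-Reasoning
      one : Fin p
      one = suc zero
      B⁻¹ : ∃ λ B → affine 0 (e zero) B ≡ one
      B⁻¹ = injective⇒surjective (affine 0 (e zero)) (affine-injective p-prime 0 (e zero) e₀≢0) one
      B = proj₁ B⁻¹
      w : Fin p → Word p n
      w a = lincomb (toℕ B) e (toℕ a) c
      S : Fin n → ℕ
      S j = sum (λ a → leeWtElt (w a j))
      w₀≡1 : ∀ a → w a zero ≡ one
      w₀≡1 a = trans (affine-vanishing (toℕ B * toℕ (e zero)) (c zero) (c-vanishes zero) a) (proj₂ B⁻¹)
      w≢0 : ∀ a → NonZeroWord (w a)
      w≢0 a = zero , λ w₀≡0 → contradiction (trans (sym (cong toℕ (w₀≡1 a))) w₀≡0) λ ()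
      S₀≡p : S zero ≡ p
      S₀≡p = begin-equality
        S zero
          ≡⟨ sum-leeWtElt-affine-vanishing (toℕ B * toℕ (e zero)) (c zero) (c-vanishes zero) ⟩
        p * leeWtElt (affine 0 (e zero) B) ≡⟨ cong (λ x → p * leeWtElt x) (proj₂ B⁻¹) ⟩
        p * 1                              ≡⟨ *-identityʳ p ⟩
        p                                  ∎
      S-middle≡0 : ∀ i → S (middle i) ≡ 0
      S-middle≡0 i = begin-equality
        S (middle i)
          ≡⟨ sum-leeWtElt-affine-vanishing (toℕ B * toℕ (e (middle i))) (c (middle i)) (c-vanishes (suc i)) ⟩
        p * leeWtElt ((toℕ B * toℕ (e (middle i))) mod p)
          ≡⟨ cong (λ x → p * leeWtElt (x mod p)) (trans (cong (toℕ B *_) (e-middle≡0 i)) (*-zeroʳ (toℕ B))) ⟩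
        p * 0                                             ≡⟨ *-zeroʳ p ⟩
        0                                                 ∎
      S-tail≡W : ∀ j → S (tail j) ≡ W
      S-tail≡W j = sum-leeWtElt-affine p-prime (toℕ B * toℕ (e (tail j))) (c (tail j)) (c-tail≢0 j)

    σᴱ : Fin (suc K) → Fin n
    σᴱ zero    = tail zero
    σᴱ (suc i) = middle i

    -- c and e vanish on k − 1 coordinates, so by hammingWt≰d′ they vanish nowhere else.
    mds-bound-normalised : ∀ {dL} → IsMinLeeDist G dL → p * dL ≤ p + W * d
    mds-bound-normalised minLee
      with c , c∈G , c≢0 , c-vanishes ← vanishing-codeword G full (s≤s (s≤s z≤n)) ≤-refl (_↑ˡ d)
      with e , e∈G , e≢0 , e-vanishes ← vanishing-codeword G full (s≤s (s≤s z≤n)) ≤-refl σᴱ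
      = line-average-bound minLee c∈G e∈G c-vanishes
          (λ j cⱼ≡0 → hammingWt≰d′ c∈G c≢0 (hammingWt≤d′ c (c-vanishes zero) (c-vanishes ∘ suc) j cⱼ≡0))
          (e-vanishes ∘ suc)
          (λ e₀≡0 → hammingWt≰d′ e∈G e≢0 (hammingWt≤d′ e e₀≡0 (e-vanishes ∘ suc) zero (e-vanishes zero)))

  private
    mds-length : ∀ K d′ n → suc d′ + suc (suc K) ≡ n + 1 → suc (K + suc d′) ≡ n
    mds-length K d′ n eq = trans (regroup K d′) (suc-injective (trans eq (+-comm n 1)))
      where
      regroup : ∀ K d′ → suc (K + suc d′) ≡ d′ + suc (suc K)
      regroup = solve-∀

  mds-bound : ∀ {k n d dL} (G : Fin k → Fin n → Fin p) → FullRank G → 2 ≤ k → d + k ≡ n + 1 →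
    IsMinDist G d → IsMinLeeDist G dL → p * dL ≤ p + W * d
  mds-bound {d = zero} G _ _ _ minDist _ = contradiction (minDist-pos {G = G} minDist) λ ()
  mds-bound {suc (suc K)} {n} {suc d′} G full (s≤s (s≤s z≤n)) d+k≡n+1 minDist minLee
    with refl ← mds-length K d′ n d+k≡n+1 = mds-bound-normalised G full minDist minLee

-- Translation to ℚ

-- `frac A a` is A / (a + 1): ℚᵘ stores the denominator minus one.
frac : ℕ → ℕ → ℚᵘ
frac A a = mkℚᵘ (+ A) a

toℚᵘ-/ : ∀ A a → toℚᵘ (+ A / suc a) ≃ᵘ frac A a
toℚᵘ-/ A a = ℚP.toℚᵘ-fromℚᵘ (frac A a)

frac-* : ∀ {x y : ℚ} {A a B b} → toℚᵘ x ≃ᵘ frac A a → toℚᵘ y ≃ᵘ frac B b →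
  toℚᵘ (x ℚ.* y) ≃ᵘ frac (A * B) (b + a * suc b)
frac-* {x} {y} {A} {a} {B} {b} x≃ y≃ = ℚᵘP.≃-trans (ℚP.toℚᵘ-homo-* x y)
  (ℚᵘP.≃-trans (ℚᵘP.*-cong x≃ y≃)
    (ℚᵘP.≃-reflexive (cong (λ z → mkℚᵘ z (b + a * suc b)) (sym (ℤP.pos-* A B)))))

frac-≤ : ∀ {x y : ℚ} {A a B b} → toℚᵘ x ≃ᵘ frac A a → toℚᵘ y ≃ᵘ frac B b →
  A * suc b ≤ B * suc a → x ℚ.≤ y
frac-≤ {A = A} {a} {B} {b} x≃ y≃ Ab≤Ba = ℚP.toℚᵘ-cancel-≤
  (ℚᵘP.≤-respˡ-≃ (ℚᵘP.≃-sym x≃) (ℚᵘP.≤-respʳ-≃ (ℚᵘP.≃-sym y≃)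
    (*≤* (subst₂ ℤ._≤_ (ℤP.pos-* A (suc b)) (ℤP.pos-* B (suc a)) (+≤+ Ab≤Ba)))))

≤-floor : ∀ a (x : ℚ) → ℕ→ℚ a ℚ.≤ x → + a ℤ.≤ ℚ.floor x
≤-floor a x@(mkℚ (+ N) d-1 _) a≤x with ℚᵘP.≤-respˡ-≃ (toℚᵘ-/ a 0) (ℚP.toℚᵘ-mono-≤ a≤x)
... | *≤* ad≤N = subst (+ a ℤ.≤_) (sym (div-pos-is-/ℕ (+ N) (suc d-1))) (+≤+ (begin
  a                       ≡⟨ m*n/n≡m a (suc d-1) ⟨
  a * suc d-1 ℕ./ suc d-1
    ≤⟨ /-monoˡ-≤ (suc d-1) (ℤP.drop‿+≤+ (subst₂ ℤ._≤_ (sym (ℤP.pos-* a (suc d-1))) (sym (ℤP.pos-* N 1)) ad≤N)) ⟩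
  N * 1 ℕ./ suc d-1       ≡⟨ cong (ℕ._/ suc d-1) (*-identityʳ N) ⟩
  N ℕ./ suc d-1           ∎))
  where open ≤-Reasoning
≤-floor a (mkℚ -[1+ N ] d-1 _) a≤x with ℚᵘP.≤-respˡ-≃ (toℚᵘ-/ a 0) (ℚP.toℚᵘ-mono-≤ a≤x)
... | *≤* ad≤-N = ⊥-elim (nonNeg≰neg (subst (ℤ._≤ _) (sym (ℤP.pos-* a (suc d-1))) ad≤-N))
  where
  nonNeg≰neg : ∀ {m} → ¬ (+ m ℤ.≤ -[1+ N ] ℤ.* + 1)
  nonNeg≰neg ()

ℕ→ℚ-+ : ∀ m n → ℕ→ℚ (m + n) ≡ ℕ→ℚ m ℚ.+ ℕ→ℚ n
ℕ→ℚ-+ m n = ℚP.toℚᵘ-injective (begin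
  toℚᵘ (ℕ→ℚ (m + n))                    ≈⟨ toℚᵘ-/ (m + n) 0 ⟩
  frac (m + n) 0                        ≈⟨ ℚᵘ.*≡* (trans (cong (ℤ._* + 1) (ℤP.pos-+ m n)) (ℤ-unit (+ m) (+ n))) ⟩
  frac m 0 ℚᵘ.+ frac n 0                ≈⟨ ℚᵘP.+-cong (toℚᵘ-/ m 0) (toℚᵘ-/ n 0) ⟨
  toℚᵘ (ℕ→ℚ m) ℚᵘ.+ toℚᵘ (ℕ→ℚ n)        ≈⟨ ℚP.toℚᵘ-homo-+ (ℕ→ℚ m) (ℕ→ℚ n) ⟨
  toℚᵘ (ℕ→ℚ m ℚ.+ ℕ→ℚ n)                ∎)
  where
  open ℚᵘP.≃-Reasoning
  ℤ-unit : ∀ (x y : ℤ) → (x ℤ.+ y) ℤ.* + 1 ≡ (x ℤ.* + 1 ℤ.+ y ℤ.* + 1) ℤ.* + 1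
  ℤ-unit = solveℤ-∀

ℕ→ℚ-∸ : ∀ m n {o} → m + n ≡ o → ℕ→ℚ o ℚ.- ℕ→ℚ n ≡ ℕ→ℚ m
ℕ→ℚ-∸ m n refl = trans (cong (ℚ._- ℕ→ℚ n) (ℕ→ℚ-+ m n)) (//-rightDividesʳ (ℕ→ℚ n) (ℕ→ℚ m))

module ℚ-bounds (μ : ℚ) (W q : ℕ) (μ≃W/[1+q] : toℚᵘ μ ≃ᵘ frac W q) where

  private
    μ*d≃ : ∀ d → toℚᵘ (μ ℚ.* ℕ→ℚ d) ≃ᵘ frac (W * d) (q * 1)
    μ*d≃ d = frac-* μ≃W/[1+q] (toℚᵘ-/ d 0)

  ≤-μ* : ∀ {a d} → suc q * a ≤ W * d → ℕ→ℚ a ℚ.≤ μ ℚ.* ℕ→ℚ d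
  ≤-μ* {a} {d} le = frac-≤ (toℚᵘ-/ a 0) (μ*d≃ d) (begin
    a * suc (q * 1) ≡⟨ cong (λ z → a * suc z) (*-identityʳ q) ⟩
    a * suc q       ≡⟨ *-comm a (suc q) ⟩
    suc q * a       ≤⟨ le ⟩
    W * d           ≡⟨ *-identityʳ (W * d) ⟨
    W * d * 1       ∎)
    where open ≤-Reasoning

  μ*-mono : ∀ {d d′} → d ≤ d′ → μ ℚ.* ℕ→ℚ d ℚ.≤ μ ℚ.* ℕ→ℚ d′
  μ*-mono d≤d′ = frac-≤ (μ*d≃ _) (μ*d≃ _) (*-monoˡ-≤ (suc (q * 1)) (*-monoʳ-≤ W d≤d′))

  ≤-floor-μ* : ∀ {a d} → suc (suc q) * a ≤ W * d →
    + a ℤ.≤ ℚ.floor ((μ ℚ.* ℕ→ℚ d) ℚ.* (+ suc q / suc (suc q)))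
  ≤-floor-μ* {a} {d} le =
    ≤-floor a _ (frac-≤ (toℚᵘ-/ a 0) (frac-* (μ*d≃ d) (toℚᵘ-/ (suc q) (suc q))) (begin
    a * suc (suc q + q * 1 * suc (suc q)) ≡⟨ reorderˡ a q ⟩
    suc q * (suc (suc q) * a)             ≤⟨ *-monoʳ-≤ (suc q) le ⟩
    suc q * (W * d)                       ≡⟨ reorderʳ q W d ⟩
    W * d * suc q * 1                     ∎))
    where
    open ≤-Reasoning
    reorderˡ : ∀ a q → a * suc (suc q + q * 1 * suc (suc q)) ≡ suc q * (suc (suc q) * a)
    reorderˡ = solve-∀
    reorderʳ : ∀ q W d → suc q * (W * d) ≡ W * d * suc q * 1
    reorderʳ = solve-∀

  mds-case : ∀ {n k d dL} → d + k ≡ n + 1 → suc (suc q) * dL ≤ suc (suc q) + W * d →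
    + dL ℤ.≤ ℚ.floor ((μ ℚ.* (ℕ→ℚ (n + 1) ℚ.- ℕ→ℚ k)) ℚ.* (+ suc q / suc (suc q))) ℤ.+ + 1
  mds-case {n} {k} {d} {dL} d+k≡n+1 bound =
    subst (λ D → + dL ℤ.≤ ℚ.floor ((μ ℚ.* D) ℚ.* (+ suc q / suc (suc q))) ℤ.+ + 1)
      (sym (ℕ→ℚ-∸ d k d+k≡n+1))
      (ℤP.≤-trans dL≤dL-1+1 (ℤP.+-monoˡ-≤ (+ 1) (≤-floor-μ* bound′)))
    where
    p = suc (suc q)
    dL≤dL-1+1 : + dL ℤ.≤ + (dL ∸ 1) ℤ.+ + 1
    dL≤dL-1+1 =
      subst (+ dL ℤ.≤_) (ℤP.pos-+ (dL ∸ 1) 1) (+≤+ (subst (dL ≤_) (+-comm 1 (dL ∸ 1)) (m≤n+m∸n dL 1)))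
    bound′ : p * (dL ∸ 1) ≤ W * d
    bound′ = begin
      p * (dL ∸ 1)     ≡⟨ *-distribˡ-∸ p dL 1 ⟩
      p * dL ∸ p * 1   ≡⟨ cong (p * dL ∸_) (*-identityʳ p) ⟩
      p * dL ∸ p       ≤⟨ ∸-monoˡ-≤ p bound ⟩
      p + W * d ∸ p    ≡⟨ m+n∸m≡n p (W * d) ⟩
      W * d            ∎
      where open ≤-Reasoning

  defect-case : ∀ {n k d dL s} → s + d + k ≡ n + 1 → 0 < s → suc q * dL ≤ W * d →
    ℕ→ℚ dL ℚ.≤ μ ℚ.* ((ℕ→ℚ (n + 1) ℚ.- ℕ→ℚ k) ℚ.- ℕ→ℚ s)
      × μ ℚ.* ((ℕ→ℚ (n + 1) ℚ.- ℕ→ℚ k) ℚ.- ℕ→ℚ s) ℚ.≤ μ ℚ.* (ℕ→ℚ n ℚ.- ℕ→ℚ k)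
  defect-case {n} {k} {d} {dL} {suc s} s+d+k≡n+1 _ bound =
    subst₂ (λ D D′ → ℕ→ℚ dL ℚ.≤ μ ℚ.* D × μ ℚ.* D ℚ.≤ μ ℚ.* D′) (sym d≡) (sym s+d≡)
      (≤-μ* bound , μ*-mono (m≤n+m d s))
    where
    d≡ : (ℕ→ℚ (n + 1) ℚ.- ℕ→ℚ k) ℚ.- ℕ→ℚ (suc s) ≡ ℕ→ℚ d
    d≡ = trans (cong (ℚ._- ℕ→ℚ (suc s)) (ℕ→ℚ-∸ (suc s + d) k s+d+k≡n+1))
               (ℕ→ℚ-∸ d (suc s) (+-comm d (suc s)))
    s+d≡ : ℕ→ℚ n ℚ.- ℕ→ℚ k ≡ ℕ→ℚ (s + d)
    s+d≡ = ℕ→ℚ-∸ (s + d) k (suc-injective (trans s+d+k≡n+1 (+-comm n 1)))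

-- μ_p as an average Lee weight

sum-toℕ≡sum-∸ : ∀ m → sum {suc m} toℕ ≡ sum {m} (λ j → m ∸ toℕ j)
sum-toℕ≡sum-∸ zero    = refl
sum-toℕ≡sum-∸ (suc m) = trans (sum-suc {suc m} toℕ) (cong (_+_ (suc m)) (sum-toℕ≡sum-∸ m))

2*sum-∸ : ∀ m → 2 * sum {m} (λ j → m ∸ toℕ j) ≡ m * suc m
2*sum-∸ zero    = refl
2*sum-∸ (suc m) = begin
  2 * (suc m + R)     ≡⟨ *-distribˡ-+ 2 (suc m) R ⟩
  2 * suc m + 2 * R   ≡⟨ cong (_+_ (2 * suc m)) (2*sum-∸ m) ⟩
  2 * suc m + m * suc m ≡⟨ regroup m ⟩
  suc m * suc (suc m) ∎
  where
  open ≡-Reasoning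
  R = sum {m} (λ j → m ∸ toℕ j)
  regroup : ∀ m → 2 * suc m + m * suc m ≡ suc m * suc (suc m)
  regroup = solve-∀

leeWtElt-↑ˡ : ∀ m (i : Fin (suc m)) → leeWtElt (i ↑ˡ m) ≡ toℕ i
leeWtElt-↑ˡ m i = trans (cong (λ t → t ⊓ (suc m + m ∸ t)) (toℕ-↑ˡ i m)) (m≤n⇒m⊓n≡m (begin
  toℕ i             ≤⟨ <⇒≤ (toℕ<n i) ⟩
  suc m             ≡⟨ m+n∸n≡m (suc m) m ⟨
  suc m + m ∸ m     ≤⟨ ∸-monoʳ-≤ (suc m + m) (≤-pred (toℕ<n i)) ⟩
  suc m + m ∸ toℕ i ∎))
  where open ≤-Reasoning

leeWtElt-↑ʳ : ∀ m (j : Fin m) → leeWtElt (suc m ↑ʳ j) ≡ m ∸ toℕ j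
leeWtElt-↑ʳ m j = begin
  leeWtElt (suc m ↑ʳ j)
    ≡⟨ cong (λ t → t ⊓ (suc m + m ∸ t)) (toℕ-↑ʳ (suc m) j) ⟩
  (suc m + toℕ j) ⊓ (suc m + m ∸ (suc m + toℕ j))
    ≡⟨ cong (_⊓_ (suc m + toℕ j)) ([m+n]∸[m+o]≡n∸o (suc m) m (toℕ j)) ⟩
  (suc m + toℕ j) ⊓ (m ∸ toℕ j)
    ≡⟨ m≥n⇒m⊓n≡n (≤-trans (m∸n≤m m (toℕ j)) (≤-trans (n≤1+n m) (m≤m+n (suc m) (toℕ j)))) ⟩
  m ∸ toℕ j
    ∎
  where open ≡-Reasoning

totalLeeWt-odd : ∀ m → totalLeeWt (suc m + m) ≡ m * suc m
totalLeeWt-odd m = begin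
  totalLeeWt (suc m + m)
    ≡⟨ sum-↑ (suc m) {m} leeWtElt ⟩
  sum {suc m} (λ i → leeWtElt (i ↑ˡ m)) + sum {m} (λ j → leeWtElt (suc m ↑ʳ j))
    ≡⟨ cong₂ _+_ (sum-cong-≗ (leeWtElt-↑ˡ m)) (sum-cong-≗ (leeWtElt-↑ʳ m)) ⟩
  sum {suc m} toℕ + R
    ≡⟨ cong (_+ R) (sum-toℕ≡sum-∸ m) ⟩
  R + R
    ≡⟨ cong (_+_ R) (+-identityʳ R) ⟨
  2 * R
    ≡⟨ 2*sum-∸ m ⟩
  m * suc m
    ∎
  where
  open ≡-Reasoning
  R = sum {m} (λ j → m ∸ toℕ j)

μ-odd : ∀ {p} → p ≢ 2 → μ p ≡ + (p + 1) / 4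
μ-odd {p} p≢2 with p ≟ 2
... | yes p≡2 = contradiction p≡2 p≢2
... | no  _   = refl

prime⇒≡2⊎odd : ∀ {p} → Prime p → p ≡ 2 ⊎ ∃ λ m → p ≡ suc (m + m)
prime⇒≡2⊎odd {p} p-prime with p % 2 in p%2≡r | m%n<n p 2
... | zero        | _ with prime⇒irreducible p-prime (m%n≡0⇒n∣m p 2 p%2≡r)
...   | inj₂ 2≡p = inj₁ (sym 2≡p)
prime⇒≡2⊎odd {p} p-prime | suc zero | _ = inj₂ (p ℕ./ 2 , (begin
  p                     ≡⟨ m≡m%n+[m/n]*n p 2 ⟩
  p % 2 + p ℕ./ 2 * 2   ≡⟨ cong (_+ p ℕ./ 2 * 2) p%2≡r ⟩
  suc (p ℕ./ 2 * 2)     ≡⟨ cong suc (*-comm (p ℕ./ 2) 2) ⟩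
  suc (2 * (p ℕ./ 2))   ≡⟨ cong (λ h → suc (p ℕ./ 2 + h)) (+-identityʳ (p ℕ./ 2)) ⟩
  suc (p ℕ./ 2 + p ℕ./ 2) ∎))
  where open ≡-Reasoning
prime⇒≡2⊎odd {p} p-prime | suc (suc _) | s≤s (s≤s ())

μ-odd-average : ∀ m → toℚᵘ (μ (suc (suc m + suc m))) ≃ᵘ frac (totalLeeWt (suc (suc m + suc m))) (m + suc m)
μ-odd-average m =
  ℚᵘP.≃-trans (ℚᵘP.≃-reflexive (cong toℚᵘ (μ-odd p≢2))) (ℚᵘP.≃-trans (toℚᵘ-/ (p + 1) 3) (*≡* (begin
  + (p + 1) ℤ.* + (p ∸ 1)                ≡⟨ ℤP.pos-* (p + 1) (p ∸ 1) ⟨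
  + ((p + 1) * (p ∸ 1))                  ≡⟨ cong +_ (cross m) ⟩
  + (suc m * suc (suc m) * 4)            ≡⟨ cong (λ W → + (W * 4)) (totalLeeWt-odd (suc m)) ⟨
  + (totalLeeWt p * 4)                   ≡⟨ ℤP.pos-* (totalLeeWt p) 4 ⟩
  + totalLeeWt p ℤ.* + 4                 ∎)))
  where
  open ≡-Reasoning
  p = suc (suc m + suc m)
  p≢2 : p ≢ 2
  p≢2 p≡2 = 0≢1+n (trans (sym (suc-injective (suc-injective p≡2))) (+-suc m m))
  cross : ∀ m → (suc (suc m + suc m) + 1) * (suc m + suc m) ≡ suc m * suc (suc m) * 4
  cross = solve-∀

μ-average : ∀ {q} → Prime (suc (suc q)) → toℚᵘ (μ (suc (suc q))) ≃ᵘ frac (totalLeeWt (suc (suc q))) q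
μ-average {zero}  _       = ℚᵘP.≃-refl
μ-average {suc q} p-prime with prime⇒≡2⊎odd p-prime
... | inj₂ (suc m , p≡2m+1) =
  subst (λ r → toℚᵘ (μ (suc (suc r))) ≃ᵘ frac (totalLeeWt (suc (suc r))) r)
    (suc-injective (suc-injective (sym p≡2m+1))) (μ-odd-average m)

module μ-bounds {q : ℕ} (p-prime : Prime (suc (suc q))) =
  ℚ-bounds (μ (suc (suc q))) (totalLeeWt (suc (suc q))) q (μ-average p-prime)

positive-defect : ∀ {d k n} → d + k ≤ n + 1 → d + k ≢ n + 1 → ∃ λ s → s + d + k ≡ n + 1 × 0 < s
positive-defect {d} {k} {n} singleton ¬mds =
  n + 1 ∸ (d + k) , trans (+-assoc (n + 1 ∸ (d + k)) d k) (m∸n+n≡m singleton) ,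
  m<n⇒0<n∸m (≤∧≢⇒< singleton ¬mds)

theorem17 : (p : ℕ) .{{_ : NonZero p}} → Prime p →
  (n k d dL : ℕ) → (G : Fin k → Fin n → Fin p) → FullRank G → 2 ≤ k →
  IsMinDist G d → IsMinLeeDist G dL →
  (d + k ≡ n + 1
    × + dL ℤ.≤ ℚ.floor ((μ p ℚ.* (ℕ→ℚ (n + 1) ℚ.- ℕ→ℚ k)) ℚ.* (+ (p ℕ.∸ 1) / p)) ℤ.+ + 1)
  ⊎ (Σ ℕ λ s → s + d + k ≡ n + 1 × 0 < s
    × ℕ→ℚ dL ℚ.≤ μ p ℚ.* ((ℕ→ℚ (n + 1) ℚ.- ℕ→ℚ k) ℚ.- ℕ→ℚ s)
    × μ p ℚ.* ((ℕ→ℚ (n + 1) ℚ.- ℕ→ℚ k) ℚ.- ℕ→ℚ s) ℚ.≤ μ p ℚ.* (ℕ→ℚ n ℚ.- ℕ→ℚ k))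
theorem17 zero          p-prime = ⊥-elim (¬prime[0] p-prime)
theorem17 (suc zero)    p-prime = ⊥-elim (¬prime[1] p-prime)
theorem17 (suc (suc q)) p-prime n k d dL G full 2≤k@(s≤s (s≤s z≤n)) minDist minLee with d + k ℕ.≟ n + 1
... | yes mds = inj₁ (mds , μ-bounds.mds-case p-prime mds (mds-bound p-prime G full 2≤k mds minDist minLee))
... | no ¬mds with s , s+d+k≡n+1 , 0<s ← positive-defect (singleton-bound (s≤s (s≤s z≤n)) G full minDist) ¬mds =
  inj₂ (s , s+d+k≡n+1 , 0<s , μ-bounds.defect-case p-prime s+d+k≡n+1 0<s (minLeeDist-bound p-prime G minDist minLee))
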